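{- Let $\mathbb{F}=\mathbb{F}_q$, $n_1,n_2\in\mathbb{N}$, $n=n_1+n_2$, and let $\mathcal{M}_i=(\mathbb{F}^{n_i},\rho_i)$, $i=1,2$, be $q$-matroids of rank $k_i$. Let $\mathcal{M}=\mathcal{M}_1\oplus\mathcal{M}_2$ and suppose $\mathcal{M}$ is representable over $\mathbb{F}_{q^m}$. Then $\mathcal{M}_1$ and $\mathcal{M}_2$ are representable over $\mathbb{F}_{q^m}$, and $\mathcal{M}=\mathcal{M}_G$ for a matrix of the form \[ G=\begin{pmatrix}G_1&0\\0&G_2\end{pmatrix}, \] where $G_i\in\mathbb{F}_{q^m}^{k_i\times n_i}$ satisfy $\mathcal{M}_{G_i}=\mathcal{M}_i$ for $i=1,2$.
   Context: A $q$-matroid with ground space $E$ (a finite-dimensional $\mathbb{F}_q$-vector space) is a pair $(E,\rho)$ with $\rho$ a map from the set of subspaces of $E$ to $\mathbb{N}_{\ge0}$ satisfying $0\le\rho(V)\le\dim V$, monotonicity, and submodularity $\rho(V+W)+\rho(V\cap W)\le\rho(V)+\rho(W)$; its rank is $\rho(E)$. Two $q$-matroids on the same ground space are equal if their rank functions agree. Representability: for $G\in\mathbb{F}_{q^m}^{k\times n}$, $\mathcal{M}_G=(\mathbb{F}_q^n,\rho_G)$ where $\rho_G(V)=\operatorname{rk}_{\mathbb{F}_{q^m}}(GY^{\mathsf T})$ for any matrix $Y$ over $\mathbb{F}_q$ with $n$ columns whose row space is $V$ (this is well defined and is a $q$-matroid). A $q$-matroid on $\mathbb{F}_q^n$ is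 representable over $\mathbb{F}_{q^m}$ if it equals $\mathcal{M}_G$ for some matrix $G$ over $\mathbb{F}_{q^m}$ with $n$ columns (whose rank equals the rank of the $q$-matroid). Direct sum: write $\mathbb{F}^n=\mathbb{F}^{n_1}\oplus\mathbb{F}^{n_2}$ with $\pi_1,\pi_2$ the projections onto the first $n_1$ and last $n_2$ coordinates. Put $\rho_i'(V)=\rho_i(\pi_i(V))$ for $V\le\mathbb{F}^n$, $\mathcal{X}=\{X\le\mathbb{F}^n\mid\rho_1'(X)+\rho_2'(X)<\dim X\}$, $\mathcal{X}_0=\mathcal{X}\cup\{0\}$. Then $\mathcal{M}_1\oplus\mathcal{M}_2=(\mathbb{F}^n,\rho)$ with $\rho(V)=\dim V+\min_{X\in\mathcal{X}_0,\,X\le V}(\rho_1'(X)+\rho_2'(X)-\dim X)$. -}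

module Defs where

open import Level using (0ℓ)
open import Data.Nat using (ℕ; zero; suc; _≤_; _<_) renaming (_+_ to _+ℕ_)
open import Data.Fin using (Fin)
open import Data.Vec using (Vec; []; _∷_; map; zipWith; replicate; foldr; take; drop; _++_; lookup; allFin; tabulate)
open import Data.Product using (Σ; ∃; _×_; _,_)
open import Data.Sum using (_⊎_)
open import Relation.Binary.PropositionalEquality using (_≡_; _≢_)
open import Relation.Nullary using (¬_)
open import Relation.Binary using (DecidableEquality)
open import Algebra.Structures using (IsCommutativeRing)

record Field : Set₁ where
  infixl 6 _+_
  infixl 7 _*_
  field
    Carrier : Set
    _+_ _*_ : Carrier → Carrier → Carrier
    -_      : Carrier → Carrier
    0# 1#   : Carrier
    isCommutativeRing : IsCommutativeRing _≡_ _+_ _*_ -_ 0# 1#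
    0≢1     : 0# ≢ 1#
    inverse : ∀ x → x ≢ 0# → Σ Carrier (λ y → x * y ≡ 1#)
    _≟_     : DecidableEquality Carrier

record HasSize (F : Field) (q : ℕ) : Set where
  open Field F
  field
    enum     : Vec Carrier q
    complete : ∀ x → Σ (Fin q) (λ i → lookup enum i ≡ x)
    injective : ∀ i j → lookup enum i ≡ lookup enum j → i ≡ j

module LinAlg (F : Field) where
  open Field F

  Vect : ℕ → Set
  Vect n = Vec Carrier n

  zeroV : ∀ {n} → Vect n
  zeroV = replicate _ 0#

  _⊕_ : ∀ {n} → Vect n → Vect n → Vect n
  _⊕_ = zipWith _+_

  _·_ : ∀ {n} → Carrier → Vect n → Vect n
  c · v = map (c *_) v

  lincomb : ∀ {n r} → Vec Carrier r → Vec (Vect n) r → Vect n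
  lincomb [] [] = zeroV
  lincomb (c ∷ cs) (v ∷ vs) = (c · v) ⊕ lincomb cs vs

  InSpan : ∀ {n r} → Vec (Vect n) r → Vect n → Set
  InSpan {r = r} vs x = Σ (Vec Carrier r) (λ c → lincomb c vs ≡ x)

  LinIndep : ∀ {n r} → Vec (Vect n) r → Set
  LinIndep {r = r} vs = ∀ (c : Vec Carrier r) → lincomb c vs ≡ zeroV → c ≡ replicate r 0#

  -- A subspace of F^n, given by a finite list of generators (its span).
  -- (Every subspace of F^n arises this way.)
  Sub : ℕ → Set
  Sub n = Σ ℕ (λ r → Vec (Vect n) r)

  _∈_ : ∀ {n} → Vect n → Sub n → Set
  x ∈ (r , vs) = InSpan vs x

  _≤S_ : ∀ {n} → Sub n → Sub n → Set
  V ≤S W = ∀ x → x ∈ V → x ∈ W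

  _≐_ : ∀ {n} → Sub n → Sub n → Set
  V ≐ W = V ≤S W × W ≤S V

  _+S_ : ∀ {n} → Sub n → Sub n → Sub n
  (r , vs) +S (s , ws) = (r +ℕ s , vs ++ ws)

  IsIntersection : ∀ {n} → Sub n → Sub n → Sub n → Set
  IsIntersection V W Z = ∀ x → (x ∈ Z → x ∈ V × x ∈ W) × (x ∈ V × x ∈ W → x ∈ Z)

  zeroS : ∀ {n} → Sub n
  zeroS = (0 , [])

  IsZeroS : ∀ {n} → Sub n → Set
  IsZeroS V = ∀ x → x ∈ V → x ≡ zeroV

  unitV : ∀ {n} → Fin n → Vect n
  unitV {n} i = tabulate (λ j → δ i j)
    where
    open import Relation.Nullary using (yes; no)
    open import Data.Fin using (_≟_)
    δ : Fin n → Fin n → Carrier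
    δ i j with i Data.Fin.≟ j
    ... | yes _ = 1#
    ... | no  _ = 0#

  fullS : ∀ n → Sub n
  fullS n = (n , tabulate unitV)

  HasDim : ∀ {n} → Sub n → ℕ → Set
  HasDim {n} V d = Σ (Vec (Vect n) d) (λ b → LinIndep b × ((d , b) ≐ V))

  π₁ : ∀ {n₁ n₂} → Sub (n₁ +ℕ n₂) → Sub n₁
  π₁ {n₁} (r , vs) = (r , map (take n₁) vs)

  π₂ : ∀ {n₁ n₂} → Sub (n₁ +ℕ n₂) → Sub n₂
  π₂ {n₁} (r , vs) = (r , map (drop n₁) vs)

record QMatroid (F : Field) (n : ℕ) : Set where
  open LinAlg F
  field
    ρ        : Sub n → ℕ
    ρ-resp   : ∀ {V W} → V ≐ W → ρ V ≡ ρ W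
    ρ-bound  : ∀ V d → HasDim V d → ρ V ≤ d
    ρ-mono   : ∀ {V W} → V ≤S W → ρ V ≤ ρ W
    ρ-submod : ∀ V W Z → IsIntersection V W Z → ρ (V +S W) +ℕ ρ Z ≤ ρ V +ℕ ρ W

  rank : ℕ
  rank = ρ (fullS n)

record Extension (K L : Field) (m : ℕ) : Set where
  module K = Field K
  module L = Field L
  field
    ι      : K.Carrier → L.Carrier
    ι-+    : ∀ a b → ι (a K.+ b) ≡ ι a L.+ ι b
    ι-*    : ∀ a b → ι (a K.* b) ≡ ι a L.* ι b
    ι-1    : ι K.1# ≡ L.1#
    basis  : Vec L.Carrier m
    spans  : ∀ (x : L.Carrier) → Σ (Vec K.Carrier m)
               (λ c → foldr _ L._+_ L.0# (zipWith (λ a b → ι a L.* b) c basis) ≡ x)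
    indep  : ∀ (c : Vec K.Carrier m) →
               foldr _ L._+_ L.0# (zipWith (λ a b → ι a L.* b) c basis) ≡ L.0# →
               c ≡ replicate m K.0#

module Rep {K L : Field} {m : ℕ} (E : Extension K L m) where
  open Extension E
  module LK = LinAlg K
  module LL = LinAlg L

  Mat : ℕ → ℕ → Set
  Mat k n = Vec (Vec L.Carrier n) k

  apply : ∀ {k n} → Mat k n → LK.Vect n → LL.Vect k
  apply G y = map (λ row → foldr _ L._+_ L.0# (zipWith L._*_ row (map ι y))) G

  -- ρ_G(V) = d : for some matrix Y over K with row space V,
  -- rk_L(G Y^T) = d (the columns of G Y^T span an L-space of dim d).
  -- (ρ_G is well defined, i.e. independent of the choice of Y.)
  RankG : ∀ {k n} → Mat k n → LK.Sub n → ℕ → Set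
  RankG {k} {n} G V d =
    Σ ℕ (λ r → Σ (Vec (LK.Vect n) r) (λ Y →
      ((r , Y) LK.≐ V) × LL.HasDim (r , map (apply G) Y) d))

  Represents : ∀ {k n} → Mat k n → QMatroid K n → Set
  Represents G M = ∀ V → RankG G V (QMatroid.ρ M V)

  Representable : ∀ {n} → QMatroid K n → Set
  Representable {n} M = Σ ℕ (λ k → Σ (Mat k n) (λ G → Represents G M))

  blockDiag : ∀ {k₁ k₂ n₁ n₂} → Mat k₁ n₁ → Mat k₂ n₂ → Mat (k₁ +ℕ k₂) (n₁ +ℕ n₂)
  blockDiag {n₁ = n₁} {n₂} G₁ G₂ =
    map (λ row → row ++ replicate n₂ L.0#) G₁ ++ map (λ row → replicate n₁ L.0# ++ row) G₂

-- Direct sum: ρ(V) = dim V + min_{X ∈ 𝒳₀, X ≤ V} (ρ₁'(X) + ρ₂'(X) − dim X)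

module DirectSum {F : Field} {n₁ n₂ : ℕ} (M₁ : QMatroid F n₁) (M₂ : QMatroid F n₂) where
  open LinAlg F
  open QMatroid M₁ renaming (ρ to ρ₁)
  open QMatroid M₂ renaming (ρ to ρ₂)

  ρ₁' ρ₂' : Sub (n₁ +ℕ n₂) → ℕ
  ρ₁' X = ρ₁ (π₁ {n₁} {n₂} X)
  ρ₂' X = ρ₂ (π₂ {n₁} {n₂} X)

  In𝒳 : Sub (n₁ +ℕ n₂) → Set
  In𝒳 X = Σ ℕ (λ d → HasDim X d × ρ₁' X +ℕ ρ₂' X < d)

  In𝒳₀ : Sub (n₁ +ℕ n₂) → Set
  In𝒳₀ X = In𝒳 X ⊎ IsZeroS X

  -- r = ρ(V) for the direct sum, with the minimum written out
  -- (all quantities moved to one side to stay in ℕ):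
  --   r + dim X ≤ dim V + ρ₁'(X) + ρ₂'(X) for all X ∈ 𝒳₀ with X ≤ V,
  --   with equality for some such X.
  IsRankDS : Sub (n₁ +ℕ n₂) → ℕ → Set
  IsRankDS V r =
    (∀ X dV dX → In𝒳₀ X → X ≤S V → HasDim V dV → HasDim X dX →
       r +ℕ dX ≤ dV +ℕ (ρ₁' X +ℕ ρ₂' X))
    × Σ (Sub (n₁ +ℕ n₂)) (λ X → In𝒳₀ X × X ≤S V ×
        Σ ℕ (λ dV → Σ ℕ (λ dX → HasDim V dV × HasDim X dX ×
           r +ℕ dX ≡ dV +ℕ (ρ₁' X +ℕ ρ₂' X))))

  IsDirectSum : QMatroid F (n₁ +ℕ n₂) → Set
  IsDirectSum M = ∀ V → IsRankDS V (QMatroid.ρ M V)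

{-# OPTIONS --safe #-}
module Submission where

open import Defs
open import Data.Nat using (ℕ; zero; suc; _≤_; _<_; z≤n; s≤s; s≤s⁻¹) renaming (_+_ to _+ℕ_)
import Data.Nat.Properties as ℕₚ
open import Data.Product using (Σ; _×_; _,_; proj₁; proj₂)
open import Data.Sum using (inj₁)
open import Data.Empty using (⊥-elim)
open import Data.Fin using (Fin; zero; suc)
import Data.Fin.Properties as Finₚ
open import Data.Vec
  using (Vec; []; _∷_; map; zipWith; replicate; foldr; take; drop; _++_; tabulate; transpose; lookup; allFin)
open import Data.Vec.Properties
  using (zipWith-assoc; zipWith-comm; zipWith-identityˡ; zipWith-identityʳ; zipWith-inverseˡ; zipWith-inverseʳ;
         zipWith-++; zipWith-is-⊛; map-replicate; map-++; map-∘; map-cong; map-id; map-const; take-map; drop-map;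
         take-zipWith; drop-zipWith; take++drop≡id; ++-injectiveˡ; ++-injectiveʳ; ∷-injectiveˡ; ∷-injectiveʳ;
         ≡-dec; lookup∘tabulate; tabulate∘lookup; tabulate-cong; tabulate-∘; tabulate-allFin)
open import Data.Vec.Relation.Unary.All as All using (All; []; _∷_)
import Data.Vec.Relation.Unary.All.Properties as Allₚ
open import Function using (_∘_; _∋_)
open import Function.Definitions using (Injective)
open import Level using (0ℓ)
open import Algebra.Bundles using (CommutativeRing; AbelianGroup)
open import Algebra.Structures using (IsAbelianGroup)
open import Relation.Binary.PropositionalEquality
open import Relation.Binary.PropositionalEquality.Algebra using (isMagma)
open import Relation.Nullary using (¬_; Dec; yes; no)
open import Relation.Nullary.Decidable using (map′)

-- The direct-sum formula determines M on each block: ρ(V ⊕ 0) = ρ₁(V) and ρ(0 ⊕ V) = ρ₂(V). Indeed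
-- X = V ⊕ 0 is admissible in the minimum when ρ₁(V) < dim V, and for any X ≤ V ⊕ 0 the rank ρ₁ drops
-- from V to π₁(X) by at most dim V − dim X; the same dimension count gives ρ(E) ≥ k₁ + k₂.
-- Let G represent M. Its columns on the first block span a space of dimension ρ(F^{n₁} ⊕ 0) = k₁;
-- writing them in a basis B₁ gives G₁ ∈ F_{q^m}^{k₁×n₁} with G (x ⊕ 0) = B₁ G₁ x, and likewise G₂. Then
-- G = (B₁ B₂) · diag(G₁, G₂), where (B₁ B₂) has independent columns because they span the column space
-- of G, whose dimension ρ(E) is at least k₁ + k₂. Multiplying by a matrix with independent columns
-- preserves ranks, so diag(G₁, G₂) represents M and each Gᵢ represents Mᵢ.

module VectorSpace (F : Field) where
  open Field F
  open LinAlg F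

  commutativeRing : CommutativeRing 0ℓ 0ℓ
  commutativeRing = record { isCommutativeRing = isCommutativeRing }

  open CommutativeRing commutativeRing
    using (+-assoc; +-comm; +-identityˡ; +-identityʳ; -‿inverseˡ; -‿inverseʳ; *-assoc; *-comm; *-identityˡ;
           *-identityʳ; distribˡ; distribʳ; zeroˡ; zeroʳ; ring; +-commutativeSemigroup; *-commutativeSemigroup)
  open import Algebra.Properties.Ring ring using (-1*x≈-x)
  open import Algebra.Properties.CommutativeSemigroup +-commutativeSemigroup using ()
    renaming (interchange to +-interchange)
  open import Algebra.Properties.CommutativeSemigroup *-commutativeSemigroup using (x∙yz≈y∙xz)

  ⊕-assoc : ∀ {n} (u v w : Vect n) → (u ⊕ v) ⊕ w ≡ u ⊕ (v ⊕ w)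
  ⊕-assoc = zipWith-assoc +-assoc

  ⊕-comm : ∀ {n} (u v : Vect n) → u ⊕ v ≡ v ⊕ u
  ⊕-comm = zipWith-comm +-comm

  ⊕-identityˡ : ∀ {n} (u : Vect n) → zeroV ⊕ u ≡ u
  ⊕-identityˡ = zipWith-identityˡ +-identityˡ

  ⊕-identityʳ : ∀ {n} (u : Vect n) → u ⊕ zeroV ≡ u
  ⊕-identityʳ = zipWith-identityʳ +-identityʳ

  ⊕-inverseˡ : ∀ {n} (u : Vect n) → ((- 1#) · u) ⊕ u ≡ zeroV
  ⊕-inverseˡ = zipWith-inverseˡ λ x → trans (cong (_+ x) (-1*x≈-x x)) (-‿inverseˡ x)

  ⊕-inverseʳ : ∀ {n} (u : Vect n) → u ⊕ ((- 1#) · u) ≡ zeroV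
  ⊕-inverseʳ = zipWith-inverseʳ λ x → trans (cong (x +_) (-1*x≈-x x)) (-‿inverseʳ x)

  ⊕-isAbelianGroup : ∀ n → IsAbelianGroup _≡_ _⊕_ (zeroV {n}) ((- 1#) ·_)
  ⊕-isAbelianGroup n = record
    { isGroup = record
      { isMonoid = record
        { isSemigroup = record { isMagma = isMagma _⊕_ ; assoc = ⊕-assoc }
        ; identity    = ⊕-identityˡ , ⊕-identityʳ
        }
      ; inverse = ⊕-inverseˡ , ⊕-inverseʳ
      ; ⁻¹-cong = cong ((- 1#) ·_)
      }
    ; comm = ⊕-comm
    }

  ⊕-abelianGroup : ℕ → AbelianGroup 0ℓ 0ℓ
  ⊕-abelianGroup n = record { isAbelianGroup = ⊕-isAbelianGroup n }

  module ⊕-Properties {n : ℕ} where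
    open import Algebra.Properties.AbelianGroup (⊕-abelianGroup n) public
    open import Algebra.Properties.CommutativeSemigroup (AbelianGroup.commutativeSemigroup (⊕-abelianGroup n))
      public using (interchange)

  open ⊕-Properties using (interchange; x∙y⁻¹≈ε⇒x≈y; inverseˡ-unique; //-rightDividesʳ)

  ·-distribˡ : ∀ {n} c (u v : Vect n) → c · (u ⊕ v) ≡ (c · u) ⊕ (c · v)
  ·-distribˡ c [] [] = refl
  ·-distribˡ c (x ∷ u) (y ∷ v) = cong₂ _∷_ (distribˡ c x y) (·-distribˡ c u v)

  ·-distribʳ : ∀ {n} a b (u : Vect n) → (a + b) · u ≡ (a · u) ⊕ (b · u)
  ·-distribʳ a b [] = refl
  ·-distribʳ a b (x ∷ u) = cong₂ _∷_ (distribʳ x a b) (·-distribʳ a b u)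

  ·-assoc : ∀ {n} a b (u : Vect n) → (a * b) · u ≡ a · (b · u)
  ·-assoc a b u = trans (map-cong (*-assoc a b) u) (map-∘ (a *_) (b *_) u)

  ·-identityˡ : ∀ {n} (u : Vect n) → 1# · u ≡ u
  ·-identityˡ u = trans (map-cong *-identityˡ u) (map-id u)

  ·-zeroˡ : ∀ {n} (u : Vect n) → 0# · u ≡ zeroV
  ·-zeroˡ u = trans (map-cong zeroˡ u) (map-const u 0#)

  ·-zeroʳ : ∀ {n} c → c · zeroV {n} ≡ zeroV
  ·-zeroʳ c = trans (map-replicate (c *_) 0# _) (cong (replicate _) (zeroʳ c))

  ·-inverseˡ : ∀ {n} a (u : Vect n) → ((- a) · u) ⊕ (a · u) ≡ zeroV
  ·-inverseˡ a u = trans (sym (·-distribʳ (- a) a u)) (trans (cong (_· u) (-‿inverseˡ a)) (·-zeroˡ u))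

  lincomb-zeroˡ : ∀ {n r} (ws : Vec (Vect n) r) → lincomb zeroV ws ≡ zeroV
  lincomb-zeroˡ [] = refl
  lincomb-zeroˡ (w ∷ ws) = trans (cong₂ _⊕_ (·-zeroˡ w) (lincomb-zeroˡ ws)) (⊕-identityˡ zeroV)

  lincomb-zeroʳ : ∀ {n r} (c : Vec Carrier r) {ws : Vec (Vect n) r} → All (_≡ zeroV) ws → lincomb c ws ≡ zeroV
  lincomb-zeroʳ [] [] = refl
  lincomb-zeroʳ (a ∷ c) (refl ∷ ws≡0) = trans (cong₂ _⊕_ (·-zeroʳ a) (lincomb-zeroʳ c ws≡0)) (⊕-identityˡ zeroV)

  lincomb-0#∷ : ∀ {n r} (c : Vec Carrier r) (w : Vect n) ws → lincomb (0# ∷ c) (w ∷ ws) ≡ lincomb c ws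
  lincomb-0#∷ c w ws = trans (cong (_⊕ lincomb c ws) (·-zeroˡ w)) (⊕-identityˡ _)

  lincomb-⊕ : ∀ {n r} (c d : Vec Carrier r) (ws : Vec (Vect n) r) →
              lincomb (c ⊕ d) ws ≡ lincomb c ws ⊕ lincomb d ws
  lincomb-⊕ [] [] [] = sym (⊕-identityˡ zeroV)
  lincomb-⊕ (a ∷ c) (b ∷ d) (w ∷ ws) =
    trans (cong₂ _⊕_ (·-distribʳ a b w) (lincomb-⊕ c d ws)) (interchange _ _ _ _)

  lincomb-· : ∀ {n r} a (c : Vec Carrier r) (ws : Vec (Vect n) r) → lincomb (a · c) ws ≡ a · lincomb c ws
  lincomb-· a [] [] = sym (·-zeroʳ a)
  lincomb-· a (b ∷ c) (w ∷ ws) =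
    trans (cong₂ _⊕_ (·-assoc a b w) (lincomb-· a c ws)) (sym (·-distribˡ a _ _))

  lincomb-++ : ∀ {n r s} (c : Vec Carrier r) (d : Vec Carrier s) (ws : Vec (Vect n) r) (vs : Vec (Vect n) s) →
               lincomb (c ++ d) (ws ++ vs) ≡ lincomb c ws ⊕ lincomb d vs
  lincomb-++ [] d [] vs = sym (⊕-identityˡ _)
  lincomb-++ (a ∷ c) d (w ∷ ws) vs = trans (cong ((a · w) ⊕_) (lincomb-++ c d ws vs)) (sym (⊕-assoc _ _ _))

  record IsLinear {a b} (f : Vect a → Vect b) : Set where
    field
      ⊕-homo : ∀ u v → f (u ⊕ v) ≡ f u ⊕ f v
      ·-homo : ∀ c u → f (c · u) ≡ c · f u

    zeroV-homo : f zeroV ≡ zeroV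
    zeroV-homo = begin
      f zeroV         ≡⟨ cong f (·-zeroˡ zeroV) ⟨
      f (0# · zeroV)  ≡⟨ ·-homo 0# zeroV ⟩
      0# · f zeroV    ≡⟨ ·-zeroˡ (f zeroV) ⟩
      zeroV           ∎
      where open ≡-Reasoning

    lincomb-homo : ∀ {r} (c : Vec Carrier r) ws → f (lincomb c ws) ≡ lincomb c (map f ws)
    lincomb-homo [] [] = zeroV-homo
    lincomb-homo (a ∷ c) (w ∷ ws) = trans (⊕-homo _ _) (cong₂ _⊕_ (·-homo a w) (lincomb-homo c ws))

  lincomb-isLinear : ∀ {n k} (bs : Vec (Vect n) k) → IsLinear (λ c → lincomb c bs)
  lincomb-isLinear bs = record { ⊕-homo = λ c d → lincomb-⊕ c d bs ; ·-homo = λ a c → lincomb-· a c bs }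

  lincomb-injective : ∀ {n k} {bs : Vec (Vect n) k} → LinIndep bs →
                      ∀ {c d} → lincomb c bs ≡ lincomb d bs → c ≡ d
  lincomb-injective {bs = bs} bs-indep {c} {d} eq = x∙y⁻¹≈ε⇒x≈y c d (bs-indep _ (begin
    lincomb (c ⊕ ((- 1#) · d)) bs           ≡⟨ lincomb-⊕ c _ bs ⟩
    lincomb c bs ⊕ lincomb ((- 1#) · d) bs  ≡⟨ cong₂ _⊕_ eq (lincomb-· (- 1#) d bs) ⟩
    lincomb d bs ⊕ ((- 1#) · lincomb d bs)  ≡⟨ ⊕-inverseʳ _ ⟩
    zeroV                                   ∎))
    where open ≡-Reasoning

  dot : ∀ {k} → Vect k → Vect k → Carrier
  dot u v = foldr _ _+_ 0# (zipWith _*_ u v)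

  dot-⊕ʳ : ∀ {k} (u v w : Vect k) → dot u (v ⊕ w) ≡ dot u v + dot u w
  dot-⊕ʳ [] [] [] = sym (+-identityʳ 0#)
  dot-⊕ʳ (x ∷ u) (y ∷ v) (z ∷ w) =
    trans (cong₂ _+_ (distribˡ x y z) (dot-⊕ʳ u v w)) (+-interchange _ _ _ _)

  dot-·ʳ : ∀ {k} (u : Vect k) c v → dot u (c · v) ≡ c * dot u v
  dot-·ʳ [] c [] = sym (zeroʳ c)
  dot-·ʳ (x ∷ u) c (y ∷ v) = trans (cong₂ _+_ (x∙yz≈y∙xz x c y) (dot-·ʳ u c v)) (sym (distribˡ c _ _))

  dot-zeroˡ : ∀ {k} (v : Vect k) → dot zeroV v ≡ 0#
  dot-zeroˡ [] = refl
  dot-zeroˡ (y ∷ v) = trans (cong₂ _+_ (zeroˡ y) (dot-zeroˡ v)) (+-identityʳ 0#)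

  dot-++ : ∀ {k l} (u : Vect k) (u′ : Vect l) v → dot (u ++ u′) v ≡ dot u (take k v) + dot u′ (drop k v)
  dot-++ [] u′ v = sym (+-identityˡ _)
  dot-++ (x ∷ u) u′ (y ∷ v) = trans (cong (x * y +_) (dot-++ u u′ v)) (sym (+-assoc _ _ _))

  infixr 7 _*ᵥ_

  _*ᵥ_ : ∀ {k n} → Vec (Vect n) k → Vect n → Vect k
  A *ᵥ v = map (λ row → dot row v) A

  *ᵥ-isLinear : ∀ {k n} (A : Vec (Vect n) k) → IsLinear (A *ᵥ_)
  *ᵥ-isLinear A = record { ⊕-homo = ⊕-homo A ; ·-homo = ·-homo A }
    where
    ⊕-homo : ∀ {k n} (A : Vec (Vect n) k) u v → A *ᵥ (u ⊕ v) ≡ (A *ᵥ u) ⊕ (A *ᵥ v)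
    ⊕-homo [] u v = refl
    ⊕-homo (row ∷ A) u v = cong₂ _∷_ (dot-⊕ʳ row u v) (⊕-homo A u v)
    ·-homo : ∀ {k n} (A : Vec (Vect n) k) c u → A *ᵥ (c · u) ≡ c · (A *ᵥ u)
    ·-homo [] c u = refl
    ·-homo (row ∷ A) c u = cong₂ _∷_ (dot-·ʳ row c u) (·-homo A c u)

  transpose-*ᵥ : ∀ {k n} (C : Vec (Vect k) n) v → transpose C *ᵥ v ≡ lincomb v C
  transpose-*ᵥ {k} [] [] = map-replicate _ [] k
  transpose-*ᵥ {n = suc n} (c ∷ C) (a ∷ v) = begin
    transpose (c ∷ C) *ᵥ (a ∷ v)            ≡⟨ cong (_*ᵥ (a ∷ v)) (zipWith-is-⊛ _∷_ c (transpose C)) ⟨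
    zipWith _∷_ c (transpose C) *ᵥ (a ∷ v)  ≡⟨ new-column c (transpose C) ⟩
    (a · c) ⊕ (transpose C *ᵥ v)            ≡⟨ cong ((a · c) ⊕_) (transpose-*ᵥ C v) ⟩
    (a · c) ⊕ lincomb v C                   ∎
    where
    open ≡-Reasoning
    new-column : ∀ {k} (c : Vect k) (R : Vec (Vect n) k) → zipWith _∷_ c R *ᵥ (a ∷ v) ≡ (a · c) ⊕ (R *ᵥ v)
    new-column [] [] = refl
    new-column (x ∷ c) (row ∷ R) = cong₂ _∷_ (cong (_+ dot row v) (*-comm x a)) (new-column c R)

  blockDiag-*ᵥ : ∀ {k₁ k₂ n₁ n₂} (A : Vec (Vect n₁) k₁) (B : Vec (Vect n₂) k₂) v →
                 (map (_++ zeroV) A ++ map (zeroV ++_) B) *ᵥ v ≡ (A *ᵥ take n₁ v) ++ (B *ᵥ drop n₁ v)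
  blockDiag-*ᵥ {n₁ = n₁} A B v = trans (map-++ _ (map (_++ zeroV) A) _)
    (cong₂ _++_ (trans (sym (map-∘ _ _ A)) (map-cong left A)) (trans (sym (map-∘ _ _ B)) (map-cong right B)))
    where
    left : ∀ row → dot (row ++ zeroV) v ≡ dot row (take n₁ v)
    left row = trans (dot-++ row zeroV v)
                     (trans (cong (dot row (take n₁ v) +_) (dot-zeroˡ (drop n₁ v))) (+-identityʳ _))
    right : ∀ row → dot (zeroV ++ row) v ≡ dot row (drop n₁ v)
    right row = trans (dot-++ zeroV row v)
                      (trans (cong (_+ dot row (drop n₁ v)) (dot-zeroˡ (take n₁ v))) (+-identityˡ _))

  -- Spans and linear independence

  ≤S-refl : ∀ {n} {V : Sub n} → V ≤S V
  ≤S-refl _ x∈V = x∈V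

  ≤S-trans : ∀ {n} {U V W : Sub n} → U ≤S V → V ≤S W → U ≤S W
  ≤S-trans U≤V V≤W x x∈U = V≤W x (U≤V x x∈U)

  InSpan-zeroV : ∀ {n r} (ws : Vec (Vect n) r) → InSpan ws zeroV
  InSpan-zeroV ws = zeroV , lincomb-zeroˡ ws

  InSpan-⊕ : ∀ {n r} {ws : Vec (Vect n) r} {x y} → InSpan ws x → InSpan ws y → InSpan ws (x ⊕ y)
  InSpan-⊕ {ws = ws} (c , refl) (d , refl) = c ⊕ d , lincomb-⊕ c d ws

  InSpan-· : ∀ {n r} {ws : Vec (Vect n) r} a {x} → InSpan ws x → InSpan ws (a · x)
  InSpan-· {ws = ws} a (c , refl) = a · c , lincomb-· a c ws

  InSpan-·⁻¹ : ∀ {n r} {ws : Vec (Vect n) r} {a x} → a ≢ 0# → InSpan ws (a · x) → InSpan ws x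
  InSpan-·⁻¹ {a = a} {x} a≢0 ax∈ws with inverse a a≢0
  ... | a⁻¹ , aa⁻¹≡1 = subst (InSpan _) a⁻¹ax≡x (InSpan-· a⁻¹ ax∈ws)
    where
    open ≡-Reasoning
    a⁻¹ax≡x : a⁻¹ · (a · x) ≡ x
    a⁻¹ax≡x = begin
      a⁻¹ · (a · x)  ≡⟨ ·-assoc a⁻¹ a x ⟨
      (a⁻¹ * a) · x  ≡⟨ cong (_· x) (trans (*-comm a⁻¹ a) aa⁻¹≡1) ⟩
      1# · x         ≡⟨ ·-identityˡ x ⟩
      x              ∎

  InSpan-∷ : ∀ {n r} {w : Vect n} {ws : Vec (Vect n) r} {x} → InSpan ws x → InSpan (w ∷ ws) x
  InSpan-∷ {w = w} {ws} (c , refl) = 0# ∷ c , lincomb-0#∷ c w ws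

  InSpan-head : ∀ {n r} {w : Vect n} {ws : Vec (Vect n) r} → InSpan (w ∷ ws) w
  InSpan-head {w = w} {ws} = 1# ∷ zeroV , trans (cong₂ _⊕_ (·-identityˡ w) (lincomb-zeroˡ ws)) (⊕-identityʳ w)

  InSpan-self : ∀ {n r} (ws : Vec (Vect n) r) → All (InSpan ws) ws
  InSpan-self [] = []
  InSpan-self (w ∷ ws) = InSpan-head ∷ All.map InSpan-∷ (InSpan-self ws)

  InSpan-trans : ∀ {n r s} {us : Vec (Vect n) r} {ws : Vec (Vect n) s} →
                 All (InSpan us) ws → ∀ {x} → InSpan ws x → InSpan us x
  InSpan-trans [] ([] , refl) = InSpan-zeroV _
  InSpan-trans (w∈us ∷ ws⊆us) (a ∷ c , refl) = InSpan-⊕ (InSpan-· a w∈us) (InSpan-trans ws⊆us (c , refl))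

  InSpan-map : ∀ {a b r} {f : Vect a → Vect b} → IsLinear f →
               ∀ {ws : Vec (Vect a) r} {x} → InSpan ws x → InSpan (map f ws) (f x)
  InSpan-map f-linear {ws} (c , refl) = c , sym (IsLinear.lincomb-homo f-linear c ws)

  InSpan-++ˡ : ∀ {n r s} {ws : Vec (Vect n) r} (vs : Vec (Vect n) s) {x} → InSpan ws x → InSpan (ws ++ vs) x
  InSpan-++ˡ {ws = ws} vs (c , refl) = c ++ zeroV ,
    trans (lincomb-++ c zeroV ws vs) (trans (cong (lincomb c ws ⊕_) (lincomb-zeroˡ vs)) (⊕-identityʳ _))

  InSpan-++ʳ : ∀ {n r s} (ws : Vec (Vect n) r) {vs : Vec (Vect n) s} {x} → InSpan vs x → InSpan (ws ++ vs) x
  InSpan-++ʳ ws {vs} (c , refl) = zeroV ++ c ,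
    trans (lincomb-++ zeroV c ws vs) (trans (cong (_⊕ lincomb c vs) (lincomb-zeroˡ ws)) (⊕-identityˡ _))

  All⇒≤S : ∀ {n r s} {us : Vec (Vect n) r} {ws : Vec (Vect n) s} → All (InSpan us) ws → (s , ws) ≤S (r , us)
  All⇒≤S ws⊆us _ = InSpan-trans ws⊆us

  ≤S⇒All : ∀ {n s} {ws : Vec (Vect n) s} {V : Sub n} → (s , ws) ≤S V → All (_∈ V) ws
  ≤S⇒All {ws = ws} ws≤V = All.map (ws≤V _) (InSpan-self ws)

  LinIndep-[] : ∀ {n} → LinIndep {n} []
  LinIndep-[] [] _ = refl

  LinIndep-∷ : ∀ {n r} {v : Vect n} {ws : Vec (Vect n) r} → LinIndep ws → ¬ InSpan ws v → LinIndep (v ∷ ws)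
  LinIndep-∷ {v = v} {ws} ws-indep v∉ws (a ∷ c) av+cws≡0 with a ≟ 0#
  ... | yes refl = cong (0# ∷_) (ws-indep c (trans (sym (lincomb-0#∷ c v ws)) av+cws≡0))
  ... | no a≢0 = ⊥-elim (v∉ws (InSpan-·⁻¹ a≢0 av∈ws))
    where
    av∈ws : InSpan ws (a · v)
    av∈ws = subst (InSpan ws) (sym (inverseˡ-unique _ _ av+cws≡0)) (InSpan-· (- 1#) (c , refl))

  LinIndep⇒head≢zeroV : ∀ {n r} {v : Vect n} {vs : Vec (Vect n) r} → LinIndep (v ∷ vs) → v ≢ zeroV
  LinIndep⇒head≢zeroV {vs = vs} indep refl = 0≢1 (sym (∷-injectiveˡ (indep (1# ∷ zeroV) lincomb≡0)))
    where
    lincomb≡0 : (1# · zeroV) ⊕ lincomb zeroV vs ≡ zeroV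
    lincomb≡0 = trans (cong₂ _⊕_ (·-zeroʳ 1#) (lincomb-zeroˡ vs)) (⊕-identityˡ zeroV)

  exchange : ∀ {n s} (b : Vec Carrier (suc s)) (ws : Vec (Vect n) (suc s)) → b ≢ zeroV →
             Σ (Vec (Vect n) s) λ ws′ → All (InSpan (lincomb b ws ∷ ws′)) ws
  exchange (β ∷ b) (w ∷ ws) b≢0 with β ≟ 0#
  exchange {s = zero} (β ∷ []) (w ∷ []) b≢0 | yes refl = ⊥-elim (b≢0 refl)
  exchange {s = suc s} (β ∷ b) (w ∷ ws) b≢0 | yes refl with exchange b ws (λ b≡0 → b≢0 (cong (0# ∷_) b≡0))
  ... | ws′ , ws⊆ = w ∷ ws′ , InSpan-∷ InSpan-head ∷ All.map (InSpan-trans old⊆new) ws⊆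
    where
    old⊆new : All (InSpan (lincomb (0# ∷ b) (w ∷ ws) ∷ w ∷ ws′)) (lincomb b ws ∷ ws′)
    old⊆new = subst (InSpan _) (lincomb-0#∷ b w ws) InSpan-head ∷ All.map (InSpan-∷ ∘ InSpan-∷) (InSpan-self ws′)
  exchange {n} (β ∷ b) (w ∷ ws) b≢0 | no β≢0 = ws , InSpan-·⁻¹ β≢0 βw∈ ∷ All.map InSpan-∷ (InSpan-self ws)
    where
    x : Vect n
    x = (β · w) ⊕ lincomb b ws
    βw∈ : InSpan (x ∷ ws) (β · w)
    βw∈ = subst (InSpan (x ∷ ws)) (//-rightDividesʳ (lincomb b ws) (β · w))
                (InSpan-⊕ InSpan-head (InSpan-∷ (InSpan-· (- 1#) (b , refl))))

  decompose-∷ : ∀ {n s t} {v : Vect n} {ws : Vec (Vect n) s} {xs : Vec (Vect n) t} → All (InSpan (v ∷ ws)) xs →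
                Σ (Vec Carrier t) λ αs → Σ (Vec (Vect n) t) λ ys →
                  All (InSpan ws) ys × (∀ c → lincomb c xs ≡ (dot c αs · v) ⊕ lincomb c ys)
  decompose-∷ {v = v} [] = [] , [] , [] , λ { [] → sym (trans (⊕-identityʳ _) (·-zeroˡ v)) }
  decompose-∷ {n} {v = v} {ws} ((α ∷ d , refl) ∷ xs⊆) with decompose-∷ xs⊆
  ... | αs , ys , ys⊆ws , xs≡ = α ∷ αs , y ∷ ys , (d , refl) ∷ ys⊆ws , λ { (a ∷ c) → split a c }
    where
    open ≡-Reasoning
    y : Vect n
    y = lincomb d ws
    split : ∀ a c → (a · ((α · v) ⊕ y)) ⊕ lincomb c _ ≡ ((a * α + dot c αs) · v) ⊕ ((a · y) ⊕ lincomb c ys)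
    split a c = begin
      (a · ((α · v) ⊕ y)) ⊕ lincomb c _                            ≡⟨ cong₂ _⊕_ (·-distribˡ a (α · v) y) (xs≡ c) ⟩
      ((a · (α · v)) ⊕ (a · y)) ⊕ ((dot c αs · v) ⊕ lincomb c ys)  ≡⟨ interchange _ _ _ _ ⟩
      ((a · (α · v)) ⊕ (dot c αs · v)) ⊕ ((a · y) ⊕ lincomb c ys)  ≡⟨ cong (λ z → (z ⊕ _) ⊕ _) (·-assoc a α v) ⟨
      (((a * α) · v) ⊕ (dot c αs · v)) ⊕ ((a · y) ⊕ lincomb c ys)  ≡⟨ cong (_⊕ _) (·-distribʳ (a * α) _ v) ⟨
      ((a * α + dot c αs) · v) ⊕ ((a · y) ⊕ lincomb c ys)          ∎

  eliminate : ∀ {n r s} {v : Vect n} {vs : Vec (Vect n) r} {ws : Vec (Vect n) s} →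
              LinIndep (v ∷ vs) → All (InSpan (v ∷ ws)) vs →
              Σ (Vec (Vect n) r) λ ys → LinIndep ys × All (InSpan ws) ys
  eliminate {v = v} {vs} indep vs⊆ with decompose-∷ vs⊆
  ... | αs , ys , ys⊆ws , vs≡ = ys , ys-indep , ys⊆ws
    where
    open ≡-Reasoning
    ys-indep : LinIndep ys
    ys-indep c cys≡0 = ∷-injectiveʳ (indep ((- δ) ∷ c) (begin
      ((- δ) · v) ⊕ lincomb c vs              ≡⟨ cong (((- δ) · v) ⊕_) (vs≡ c) ⟩
      ((- δ) · v) ⊕ ((δ · v) ⊕ lincomb c ys)  ≡⟨ cong (λ z → ((- δ) · v) ⊕ ((δ · v) ⊕ z)) cys≡0 ⟩
      ((- δ) · v) ⊕ ((δ · v) ⊕ zeroV)         ≡⟨ cong (((- δ) · v) ⊕_) (⊕-identityʳ _) ⟩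
      ((- δ) · v) ⊕ (δ · v)                   ≡⟨ ·-inverseˡ δ v ⟩
      zeroV                                   ∎))
      where
      δ : Carrier
      δ = dot c αs

  steinitz : ∀ {n r s} {vs : Vec (Vect n) r} {ws : Vec (Vect n) s} → LinIndep vs → All (InSpan ws) vs → r ≤ s
  steinitz {vs = []} _ _ = z≤n
  steinitz {vs = v ∷ vs} {[]} indep (([] , v≡0) ∷ _) = ⊥-elim (LinIndep⇒head≢zeroV indep (sym v≡0))
  steinitz {r = suc r} {suc s} {vs = _ ∷ vs} {w ∷ ws} indep ((b , refl) ∷ vs⊆) with ≡-dec _≟_ b zeroV
  ... | yes refl = ⊥-elim (LinIndep⇒head≢zeroV indep (lincomb-zeroˡ (w ∷ ws)))
  ... | no b≢0 with exchange b (w ∷ ws) b≢0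
  ...   | ws′ , ws⊆ with eliminate indep (All.map (InSpan-trans ws⊆) vs⊆)
  ...     | ys , ys-indep , ys⊆ws′ = s≤s (steinitz ys-indep ys⊆ws′)

  spanning⇒LinIndep : ∀ {n s t} {xs : Vec (Vect n) s} {bs : Vec (Vect n) t} →
                      LinIndep bs → All (InSpan xs) bs → s ≤ t → LinIndep xs
  spanning⇒LinIndep {s = zero} {xs = []} _ _ _ [] _ = refl
  spanning⇒LinIndep {s = suc s} {xs = xs} bs-indep bs⊆xs s≤t c cxs≡0 with ≡-dec _≟_ c zeroV
  ... | yes c≡0 = c≡0
  ... | no c≢0 with exchange c xs c≢0
  ...   | ws′ , xs⊆ = ⊥-elim (ℕₚ.<⇒≱ s≤t (steinitz bs-indep (All.map (InSpan-trans xs⊆ws′) bs⊆xs)))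
    where
    zeroV∷ws′⊆ws′ : All (InSpan ws′) (lincomb c xs ∷ ws′)
    zeroV∷ws′⊆ws′ = subst (InSpan ws′) (sym cxs≡0) (InSpan-zeroV ws′) ∷ InSpan-self ws′
    xs⊆ws′ : All (InSpan ws′) xs
    xs⊆ws′ = All.map (InSpan-trans zeroV∷ws′⊆ws′) xs⊆

  IsIntersection-line : ∀ {n r} {v : Vect n} {ws : Vec (Vect n) r} → ¬ InSpan ws v →
                        IsIntersection (1 , v ∷ []) (r , ws) zeroS
  IsIntersection-line {v = v} {ws} v∉ws x =
    (λ { ([] , refl) → InSpan-zeroV _ , InSpan-zeroV ws }) , λ { ((a ∷ [] , refl) , av∈ws) → on-line a av∈ws }
    where
    on-line : ∀ a → InSpan ws ((a · v) ⊕ zeroV) → InSpan [] ((a · v) ⊕ zeroV)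
    on-line a av∈ws with a ≟ 0#
    ... | yes refl = [] , sym (trans (⊕-identityʳ _) (·-zeroˡ v))
    ... | no a≢0 = ⊥-elim (v∉ws (InSpan-·⁻¹ a≢0 (subst (InSpan ws) (⊕-identityʳ _) av∈ws)))

  coordinates : ∀ {n k t} {b : Vec (Vect n) k} {xs : Vec (Vect n) t} → All (InSpan b) xs →
                Σ (Vec (Vect k) t) λ C → map (λ c → lincomb c b) C ≡ xs
  coordinates [] = [] , refl
  coordinates ((c , refl) ∷ xs⊆b) with coordinates xs⊆b
  ... | C , refl = c ∷ C , refl

  -- Dimension

  HasDim-zero : ∀ {n r} {zs : Vec (Vect n) r} → All (_≡ zeroV) zs → HasDim (r , zs) 0
  HasDim-zero {zs = zs} zs≡0 =
    [] , LinIndep-[] , (λ { _ ([] , refl) → InSpan-zeroV zs })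
       , λ { _ (c , refl) → [] , sym (lincomb-zeroʳ c zs≡0) }

  LinIndep⇒length≤dim : ∀ {n r d} {vs : Vec (Vect n) r} {V : Sub n} →
                        LinIndep vs → All (_∈ V) vs → HasDim V d → r ≤ d
  LinIndep⇒length≤dim vs-indep vs⊆V (_ , _ , _ , V≤b) = steinitz vs-indep (All.map (V≤b _) vs⊆V)

  dim≤length : ∀ {n s d} {V : Sub n} {ws : Vec (Vect n) s} → HasDim V d → V ≤S (s , ws) → d ≤ s
  dim≤length (b , b-indep , b≤V , _) V≤ws = steinitz b-indep (≤S⇒All (≤S-trans b≤V V≤ws))

  HasDim-unique : ∀ {n d e} {V : Sub n} → HasDim V d → HasDim V e → d ≡ e
  HasDim-unique V-dim@(b , b-indep , b≤V , _) V-dim′@(b′ , b′-indep , b′≤V , _) =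
    ℕₚ.≤-antisym (LinIndep⇒length≤dim b-indep (≤S⇒All b≤V) V-dim′)
                 (LinIndep⇒length≤dim b′-indep (≤S⇒All b′≤V) V-dim)

  mapS : ∀ {a b} → (Vect a → Vect b) → Sub a → Sub b
  mapS f (r , vs) = r , map f vs

  mapS-id : ∀ {n} (V : Sub n) → mapS (λ u → u) V ≡ V
  mapS-id (r , vs) = cong (r ,_) (map-id vs)

  mapS-mono : ∀ {a b} {f : Vect a → Vect b} → IsLinear f → ∀ {V W} → V ≤S W → mapS f V ≤S mapS f W
  mapS-mono {f = f} f-linear {r , vs} V≤W _ (c , refl) =
    subst (_∈ mapS f _) (IsLinear.lincomb-homo f-linear c vs) (InSpan-map f-linear (V≤W _ (c , refl)))

  InjectiveOn : ∀ {a b} → Sub a → (Vect a → Vect b) → Set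
  InjectiveOn V f = ∀ {x y} → x ∈ V → y ∈ V → f x ≡ f y → x ≡ y

  HasDim-mapS⁺ : ∀ {a b d} {f : Vect a → Vect b} {V : Sub a} →
                 IsLinear f → InjectiveOn V f → HasDim V d → HasDim (mapS f V) d
  HasDim-mapS⁺ {f = f} {V = r , vs} f-linear f-inj (b , b-indep , b≤V , V≤b) =
    map f b , fb-indep , mapS-mono f-linear b≤V , mapS-mono f-linear V≤b
    where
    open IsLinear f-linear
    fb-indep : LinIndep (map f b)
    fb-indep c fcb≡0 = b-indep c (f-inj (b≤V _ (c , refl)) (InSpan-zeroV vs)
                                         (trans (lincomb-homo c b) (trans fcb≡0 (sym zeroV-homo))))

  HasDim-mapS⁻ : ∀ {a b d} {f : Vect a → Vect b} {V : Sub a} → IsLinear f → Injective _≡_ _≡_ f →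
                 HasDim (mapS f V) d → HasDim V d
  HasDim-mapS⁻ {a} {d = d} {f} {r , vs} f-linear f-inj (bs , bs-indep , bs≤fV , fV≤bs) = b , b-indep , b≤V , V≤b
    where
    open IsLinear f-linear
    open ≡-Reasoning
    C : Vec (Vect r) d
    C = proj₁ (coordinates (≤S⇒All bs≤fV))
    b : Vec (Vect a) d
    b = map (λ c → lincomb c vs) C
    fb≡bs : map f b ≡ bs
    fb≡bs = begin
      map f b                             ≡⟨ map-∘ f _ C ⟨
      map (λ c → f (lincomb c vs)) C      ≡⟨ map-cong (λ c → lincomb-homo c vs) C ⟩
      map (λ c → lincomb c (map f vs)) C  ≡⟨ proj₂ (coordinates (≤S⇒All bs≤fV)) ⟩
      bs                                  ∎
    f-lincomb-b : ∀ e → f (lincomb e b) ≡ lincomb e bs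
    f-lincomb-b e = trans (lincomb-homo e b) (cong (lincomb e) fb≡bs)
    b-indep : LinIndep b
    b-indep e eb≡0 = bs-indep e (trans (sym (f-lincomb-b e)) (trans (cong f eb≡0) zeroV-homo))
    b≤V : (d , b) ≤S (r , vs)
    b≤V = All⇒≤S (Allₚ.map⁺ (All.universal (λ c → c , refl) C))
    V≤b : (r , vs) ≤S (d , b)
    V≤b x x∈V with fV≤bs (f x) (InSpan-map f-linear x∈V)
    ... | e , ebs≡fx = e , f-inj (trans (f-lincomb-b e) ebs≡fx)

  -- Block coordinates and unit vectors

  record LinearRetract (a n : ℕ) : Set where
    field
      embed            : Vect a → Vect n
      project          : Vect n → Vect a
      embed-isLinear   : IsLinear embed
      project-isLinear : IsLinear project
      project∘embed    : ∀ u → project (embed u) ≡ u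

    embed-injectiveOn : ∀ {V} → InjectiveOn V embed
    embed-injectiveOn _ _ eq = trans (sym (project∘embed _)) (trans (cong project eq) (project∘embed _))

    embed∘project-image : ∀ {U x} → x ∈ mapS embed U → embed (project x) ≡ x
    embed∘project-image {r , us} (c , refl) = begin
      embed (project (lincomb c (map embed us)))  ≡⟨ cong (embed ∘ project) (lincomb-homo c us) ⟨
      embed (project (embed (lincomb c us)))      ≡⟨ cong embed (project∘embed _) ⟩
      embed (lincomb c us)                        ≡⟨ lincomb-homo c us ⟩
      lincomb c (map embed us)                    ∎
      where
      open IsLinear embed-isLinear
      open ≡-Reasoning

    project-injectiveOn : ∀ {U X} → X ≤S mapS embed U → InjectiveOn X project
    project-injectiveOn X≤ x∈X y∈X eq =
      trans (sym (embed∘project-image (X≤ _ x∈X))) (trans (cong embed eq) (embed∘project-image (X≤ _ y∈X)))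

    mapS-project-embed : ∀ U → mapS project (mapS embed U) ≡ U
    mapS-project-embed (r , us) =
      cong (r ,_) (trans (sym (map-∘ project embed us)) (trans (map-cong project∘embed us) (map-id us)))

    mapS-project-≐ : ∀ {Y U} → Y ≐ mapS embed U → mapS project Y ≐ U
    mapS-project-≐ {Y} {U} (Y≤ , ≤Y) =
      subst (mapS project Y ≤S_) (mapS-project-embed U) (mapS-mono project-isLinear Y≤) ,
      subst (_≤S mapS project Y) (mapS-project-embed U) (mapS-mono project-isLinear ≤Y)

  idRetract : ∀ {n} → LinearRetract n n
  idRetract = record
    { embed            = λ u → u
    ; project          = λ u → u
    ; embed-isLinear   = id-isLinear
    ; project-isLinear = id-isLinear
    ; project∘embed    = λ _ → refl
    }
    where
    id-isLinear : IsLinear (λ u → u)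
    id-isLinear = record { ⊕-homo = λ _ _ → refl ; ·-homo = λ _ _ → refl }

  take-++ : ∀ {k l} (u : Vect k) (v : Vect l) → take k (u ++ v) ≡ u
  take-++ {k} u v = ++-injectiveˡ (take k (u ++ v)) u (take++drop≡id k (u ++ v))

  drop-++ : ∀ {k l} (u : Vect k) (v : Vect l) → drop k (u ++ v) ≡ v
  drop-++ {k} u v = ++-injectiveʳ (take k (u ++ v)) u (take++drop≡id k (u ++ v))

  take-isLinear : ∀ k {l} → IsLinear (take k {l})
  take-isLinear k = record { ⊕-homo = take-zipWith _+_ ; ·-homo = λ c → take-map (c *_) k }

  drop-isLinear : ∀ k {l} → IsLinear (drop k {l})
  drop-isLinear k = record { ⊕-homo = drop-zipWith _+_ ; ·-homo = λ c → drop-map (c *_) k }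

  take++drop-⊕ : ∀ k {l} (y : Vect (k +ℕ l)) → (take k y ++ zeroV) ⊕ (zeroV ++ drop k y) ≡ y
  take++drop-⊕ k y = trans (zipWith-++ _+_ (take k y) zeroV zeroV (drop k y))
    (trans (cong₂ _++_ (⊕-identityʳ (take k y)) (⊕-identityˡ (drop k y))) (take++drop≡id k y))

  takeRetract : ∀ n₁ n₂ → LinearRetract n₁ (n₁ +ℕ n₂)
  takeRetract n₁ n₂ = record
    { embed            = _++ zeroV
    ; project          = take n₁
    ; embed-isLinear   = record { ⊕-homo = ⊕-homo ; ·-homo = ·-homo }
    ; project-isLinear = take-isLinear n₁
    ; project∘embed    = λ u → take-++ u zeroV
    }
    where
    ⊕-homo : ∀ u v → (u ⊕ v) ++ zeroV {n₂} ≡ (u ++ zeroV) ⊕ (v ++ zeroV)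
    ⊕-homo u v = trans (cong ((u ⊕ v) ++_) (sym (⊕-identityˡ zeroV))) (sym (zipWith-++ _+_ u zeroV v zeroV))
    ·-homo : ∀ c u → (c · u) ++ zeroV {n₂} ≡ c · (u ++ zeroV)
    ·-homo c u = trans (cong ((c · u) ++_) (sym (·-zeroʳ c))) (sym (map-++ (c *_) u zeroV))

  dropRetract : ∀ n₁ n₂ → LinearRetract n₂ (n₁ +ℕ n₂)
  dropRetract n₁ n₂ = record
    { embed            = zeroV ++_
    ; project          = drop n₁
    ; embed-isLinear   = record { ⊕-homo = ⊕-homo ; ·-homo = ·-homo }
    ; project-isLinear = drop-isLinear n₁
    ; project∘embed    = drop-++ (zeroV {n₁})
    }
    where
    ⊕-homo : ∀ u v → zeroV {n₁} ++ (u ⊕ v) ≡ (zeroV ++ u) ⊕ (zeroV ++ v)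
    ⊕-homo u v = trans (cong (_++ (u ⊕ v)) (sym (⊕-identityˡ zeroV))) (sym (zipWith-++ _+_ zeroV u zeroV v))
    ·-homo : ∀ c u → zeroV {n₁} ++ (c · u) ≡ c · (zeroV ++ u)
    ·-homo c u = trans (cong (_++ (c · u)) (sym (·-zeroʳ c))) (sym (map-++ (c *_) zeroV u))

  -- unitV is defined by an anonymous case split on i ≟ j; abstracting over i ≟ j makes both lookups compute.
  lookup-unitV-suc : ∀ {n} (i j : Fin n) → lookup (unitV (suc i)) (suc j) ≡ lookup (unitV i) j
  lookup-unitV-suc i j
    with i Finₚ.≟ j | (lookup (unitV (suc i)) (suc j) ≡ _) ∋ lookup∘tabulate _ j
                    | (lookup (unitV i) j ≡ _) ∋ lookup∘tabulate _ j
  ... | yes _ | lhs≡1 | rhs≡1 = trans lhs≡1 (sym rhs≡1)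
  ... | no _  | lhs≡0 | rhs≡0 = trans lhs≡0 (sym rhs≡0)

  unitV-zero : ∀ {n} → unitV {suc n} zero ≡ 1# ∷ zeroV
  unitV-zero {n} = cong (1# ∷_) (trans (tabulate-allFin _) (map-const (allFin n) 0#))

  unitV-suc : ∀ {n} (i : Fin n) → unitV (suc i) ≡ 0# ∷ unitV i
  unitV-suc i = cong (0# ∷_)
    (trans (sym (tabulate∘lookup _)) (trans (tabulate-cong (lookup-unitV-suc i)) (tabulate∘lookup _)))

  lincomb-unitV : ∀ {n} (c : Vect n) → lincomb c (tabulate unitV) ≡ c
  lincomb-unitV [] = refl
  lincomb-unitV {suc n} (a ∷ c) = begin
    (a · unitV zero) ⊕ lincomb c (tabulate (unitV ∘ suc))
      ≡⟨ cong₂ (λ u us → (a · u) ⊕ lincomb c us) unitV-zero units-suc ⟩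
    (a · (1# ∷ zeroV)) ⊕ lincomb c (map (0# ∷_) (tabulate unitV))
      ≡⟨ cong (_ ⊕_) (lincomb-homo c _) ⟨
    (a · (1# ∷ zeroV)) ⊕ (0# ∷ lincomb c (tabulate unitV))
      ≡⟨ cong (λ u → (a · (1# ∷ zeroV)) ⊕ (0# ∷ u)) (lincomb-unitV c) ⟩
    (a · (1# ∷ zeroV)) ⊕ (0# ∷ c)
      ≡⟨ cong₂ _∷_ a*1+0≡a a·0+c≡c ⟩
    a ∷ c
      ∎
    where
    open ≡-Reasoning
    -- 0# ∷_ is the embedding zeroV {1} ++_ of the second block.
    open IsLinear (LinearRetract.embed-isLinear (dropRetract 1 n))
    units-suc : tabulate (unitV ∘ suc) ≡ map (0# ∷_) (tabulate unitV)
    units-suc = trans (tabulate-cong unitV-suc) (tabulate-∘ (0# ∷_) unitV)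
    a*1+0≡a : a * 1# + 0# ≡ a
    a*1+0≡a = trans (+-identityʳ _) (*-identityʳ a)
    a·0+c≡c : (a · zeroV) ⊕ c ≡ c
    a·0+c≡c = trans (cong (_⊕ c) (·-zeroʳ a)) (⊕-identityˡ c)

  ∈-fullS : ∀ {n} (x : Vect n) → x ∈ fullS n
  ∈-fullS x = x , lincomb-unitV x

  HasDim-fullS : ∀ n → HasDim (fullS n) n
  HasDim-fullS n = tabulate unitV , (λ c c≡0 → trans (sym (lincomb-unitV c)) c≡0) , ≤S-refl , ≤S-refl

-- Finiteness of the field is used only here: it makes span membership decidable,
-- so bases can be chosen greedily.
module FiniteField (F : Field) {q : ℕ} (F-size : HasSize F q) where
  open Field F
  open LinAlg F
  open VectorSpace F
  open HasSize F-size

  ∃-Carrier? : (P : Carrier → Set) → (∀ a → Dec (P a)) → Dec (Σ Carrier P)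
  ∃-Carrier? P P? = map′ (λ (i , p) → lookup enum i , p) (λ (a , p) → in-enum a p) (Finₚ.any? (P? ∘ lookup enum))
    where
    in-enum : ∀ a → P a → Σ (Fin q) (P ∘ lookup enum)
    in-enum a p with complete a
    ... | i , refl = i , p

  ∃-Vec? : ∀ r (P : Vec Carrier r → Set) → (∀ c → Dec (P c)) → Dec (Σ (Vec Carrier r) P)
  ∃-Vec? zero P P? = map′ ([] ,_) (λ { ([] , p) → p }) (P? [])
  ∃-Vec? (suc r) P P? = map′ (λ (a , c , p) → a ∷ c , p) (λ { (a ∷ c , p) → a , c , p })
                             (∃-Carrier? _ λ a → ∃-Vec? r (P ∘ (a ∷_)) (P? ∘ (a ∷_)))

  InSpan? : ∀ {n r} (ws : Vec (Vect n) r) x → Dec (InSpan ws x)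
  InSpan? {r = r} ws x = ∃-Vec? r _ λ c → ≡-dec _≟_ (lincomb c ws) x

  record BasisExtension {n w t} (W : Vec (Vect n) w) (vs : Vec (Vect n) t) : Set where
    field
      size        : ℕ
      basis       : Vec (Vect n) size
      basis-indep : LinIndep basis
      W⊆basis     : All (InSpan basis) W
      vs⊆basis    : All (InSpan basis) vs
      basis⊆      : ∀ {u} {U : Vec (Vect n) u} → All (InSpan U) W → All (InSpan U) vs → All (InSpan U) basis

  extend : ∀ {n w t} (W : Vec (Vect n) w) → LinIndep W → (vs : Vec (Vect n) t) → BasisExtension W vs
  extend W W-indep [] = record
    { size = _ ; basis = W ; basis-indep = W-indep
    ; W⊆basis = InSpan-self W ; vs⊆basis = [] ; basis⊆ = λ W⊆U _ → W⊆U
    }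
  extend W W-indep (v ∷ vs) with InSpan? W v
  ... | yes v∈W = record
    { size = size ; basis = basis ; basis-indep = basis-indep
    ; W⊆basis = W⊆basis ; vs⊆basis = InSpan-trans W⊆basis v∈W ∷ vs⊆basis
    ; basis⊆ = λ { W⊆U (_ ∷ vs⊆U) → basis⊆ W⊆U vs⊆U }
    }
    where open BasisExtension (extend W W-indep vs)
  ... | no v∉W = record
    { size = size ; basis = basis ; basis-indep = basis-indep
    ; W⊆basis = All.tail W⊆basis ; vs⊆basis = All.head W⊆basis ∷ vs⊆basis
    ; basis⊆ = λ { W⊆U (v∈U ∷ vs⊆U) → basis⊆ (v∈U ∷ W⊆U) vs⊆U }
    }
    where open BasisExtension (extend (v ∷ W) (LinIndep-∷ W-indep v∉W) vs)

  HasDim-exists : ∀ {n} (V : Sub n) → Σ ℕ (HasDim V)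
  HasDim-exists (r , us) = size , basis , basis-indep , All⇒≤S (basis⊆ [] (InSpan-self us)) , All⇒≤S vs⊆basis
    where open BasisExtension (extend [] LinIndep-[] us)

module RankFunction (F : Field) {q : ℕ} (F-size : HasSize F q) {n : ℕ} (M : QMatroid F n) where
  open LinAlg F
  open VectorSpace F
  open FiniteField F F-size
  open QMatroid M
  open ℕₚ using (≤-refl; ≤-reflexive; n≤0⇒n≡0; m≤m+n; +-monoˡ-≤; +-mono-≤; +-suc)
  open ℕₚ.≤-Reasoning

  ρ-zero : ∀ {r} {zs : Vec (Vect n) r} → All (_≡ zeroV) zs → ρ (r , zs) ≡ 0
  ρ-zero zs≡0 = n≤0⇒n≡0 (ρ-bound _ 0 (HasDim-zero zs≡0))

  ρ-∷ : ∀ {r} {v : Vect n} {ws : Vec (Vect n) r} → ¬ InSpan ws v → ρ (suc r , v ∷ ws) ≤ suc (ρ (r , ws))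
  ρ-∷ {r} {v} {ws} v∉ws = begin
    ρ (suc r , v ∷ ws)             ≤⟨ m≤m+n _ _ ⟩
    ρ (suc r , v ∷ ws) +ℕ ρ zeroS  ≤⟨ ρ-submod (1 , v ∷ []) (r , ws) zeroS (IsIntersection-line v∉ws) ⟩
    ρ (1 , v ∷ []) +ℕ ρ (r , ws)   ≤⟨ +-monoˡ-≤ _ (ρ-bound _ 1 line-dim) ⟩
    suc (ρ (r , ws))               ∎
    where
    line-dim : HasDim (1 , v ∷ []) 1
    line-dim = v ∷ [] , LinIndep-∷ LinIndep-[] (λ { ([] , refl) → v∉ws (InSpan-zeroV ws) }) , ≤S-refl , ≤S-refl

  ρ-extend : ∀ {w t} (W : Vec (Vect n) w) (W-indep : LinIndep W) (vs : Vec (Vect n) t) →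
             let open BasisExtension (extend W W-indep vs) in ρ (size , basis) +ℕ w ≤ ρ (w , W) +ℕ size
  ρ-extend W W-indep [] = ≤-refl
  ρ-extend W W-indep (v ∷ vs) with InSpan? W v
  ... | yes _ = ρ-extend W W-indep vs
  ... | no v∉W = s≤s⁻¹ (begin
    suc (ρ (size , basis) +ℕ _)  ≡⟨ +-suc _ _ ⟨
    ρ (size , basis) +ℕ suc _    ≤⟨ ρ-extend (v ∷ W) (LinIndep-∷ W-indep v∉W) vs ⟩
    ρ (suc _ , v ∷ W) +ℕ size    ≤⟨ +-monoˡ-≤ size (ρ-∷ v∉W) ⟩
    suc (ρ (_ , W) +ℕ size)      ∎)
    where open BasisExtension (extend (v ∷ W) (LinIndep-∷ W-indep v∉W) vs)

  ρ-gap≤dim-gap : ∀ {U′ U : Sub n} {u′ u} → U′ ≤S U → HasDim U′ u′ → HasDim U u → ρ U +ℕ u′ ≤ ρ U′ +ℕ u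
  ρ-gap≤dim-gap {r′ , us′} {r , us} {u′} {u} U′≤U (b′ , b′-indep , b′≤U′ , U′≤b′) U-dim = begin
    ρ (r , us) +ℕ u′        ≡⟨ cong (_+ℕ u′) (ρ-resp (All⇒≤S basis⊆us , All⇒≤S vs⊆basis)) ⟨
    ρ (size , basis) +ℕ u′  ≤⟨ ρ-extend b′ b′-indep us ⟩
    ρ (u′ , b′) +ℕ size     ≤⟨ +-mono-≤ (≤-reflexive (ρ-resp (b′≤U′ , U′≤b′))) size≤u ⟩
    ρ (r′ , us′) +ℕ u       ∎
    where
    open BasisExtension (extend b′ b′-indep us)
    basis⊆us : All (InSpan us) basis
    basis⊆us = basis⊆ (≤S⇒All (≤S-trans b′≤U′ U′≤U)) (InSpan-self us)
    size≤u : size ≤ u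
    size≤u = LinIndep⇒length≤dim basis-indep basis⊆us U-dim

module DirectSumRank (K : Field) {q : ℕ} (K-size : HasSize K q) {n₁ n₂ : ℕ}
                     (M₁ : QMatroid K n₁) (M₂ : QMatroid K n₂) (M : QMatroid K (n₁ +ℕ n₂))
                     (M-ds : DirectSum.IsDirectSum M₁ M₂ M) where
  open LinAlg K
  open VectorSpace K
  open FiniteField K K-size
  open DirectSum M₁ M₂ using (ρ₁'; ρ₂')
  open QMatroid M using (ρ; ρ-bound)
  open QMatroid M₁ using () renaming (ρ to ρ₁)
  open QMatroid M₂ using () renaming (ρ to ρ₂)
  open ℕₚ using (≤-reflexive; ≤-trans; ≤-antisym; m≤m+n; m≤n+m; +-monoʳ-≤; +-mono-≤; +-comm; +-identityʳ;
                 +-cancelʳ-≤; _<?_; ≮⇒≥)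
  open import Algebra.Properties.CommutativeSemigroup ℕₚ.+-commutativeSemigroup using ()
    renaming (interchange to +-interchange)
  open ℕₚ.≤-Reasoning

  σ : Sub (n₁ +ℕ n₂) → ℕ
  σ X = ρ₁' X +ℕ ρ₂' X

  module _ {a} (N : QMatroid K a) (R : LinearRetract a (n₁ +ℕ n₂))
           (σ-embed : ∀ U → σ (mapS (LinearRetract.embed R) U) ≡ QMatroid.ρ N U)
           (ρ-project≤σ : ∀ X → QMatroid.ρ N (mapS (LinearRetract.project R) X) ≤ σ X) where
    open LinearRetract R
    open QMatroid N using () renaming (ρ to ρN)
    open RankFunction K K-size N using (ρ-gap≤dim-gap)

    ρ-embed : ∀ U → ρ (mapS embed U) ≡ ρN U
    ρ-embed U with HasDim-exists U
    ... | u , U-dim = ≤-antisym upper lower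
      where
      V : Sub (n₁ +ℕ n₂)
      V = mapS embed U
      V-dim : HasDim V u
      V-dim = HasDim-mapS⁺ embed-isLinear embed-injectiveOn U-dim

      upper : ρ V ≤ ρN U
      upper with ρN U <? u
      ... | no ρU≮u = ≤-trans (ρ-bound V u V-dim) (≮⇒≥ ρU≮u)
      ... | yes ρU<u = +-cancelʳ-≤ u _ _ (begin
        ρ V +ℕ u   ≤⟨ proj₁ (M-ds V) V u u (inj₁ (u , V-dim , σV<u)) ≤S-refl V-dim V-dim ⟩
        u +ℕ σ V   ≡⟨ cong (u +ℕ_) (σ-embed U) ⟩
        u +ℕ ρN U  ≡⟨ +-comm u _ ⟩
        ρN U +ℕ u  ∎)
        where
        σV<u : σ V < u
        σV<u = subst (_< u) (sym (σ-embed U)) ρU<u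

      lower : ρN U ≤ ρ V
      lower with proj₂ (M-ds V)
      ... | X , _ , X≤V , dV , dX , V-dim′ , X-dim , ρV+dX≡dV+σX = +-cancelʳ-≤ dX _ _ (begin
        ρN U +ℕ dX                ≤⟨ ρ-gap≤dim-gap pX≤U pX-dim U-dim ⟩
        ρN (mapS project X) +ℕ u  ≤⟨ +-mono-≤ (ρ-project≤σ X) (≤-reflexive (HasDim-unique V-dim V-dim′)) ⟩
        σ X +ℕ dV                 ≡⟨ +-comm (σ X) dV ⟩
        dV +ℕ σ X                 ≡⟨ ρV+dX≡dV+σX ⟨
        ρ V +ℕ dX                 ∎)
        where
        pX≤U : mapS project X ≤S U
        pX≤U = subst (mapS project X ≤S_) (mapS-project-embed U) (mapS-mono project-isLinear X≤V)
        pX-dim : HasDim (mapS project X) dX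
        pX-dim = HasDim-mapS⁺ project-isLinear (project-injectiveOn X≤V) X-dim

  ρ-first : ∀ U → ρ (mapS (_++ zeroV) U) ≡ ρ₁ U
  ρ-first = ρ-embed M₁ (takeRetract n₁ n₂) σ-embed (λ X → m≤m+n _ _)
    where
    σ-embed : ∀ U → σ (mapS (_++ zeroV) U) ≡ ρ₁ U
    σ-embed U@(_ , us) = trans
      (cong₂ _+ℕ_ (cong ρ₁ (LinearRetract.mapS-project-embed (takeRetract n₁ n₂) U))
                  (RankFunction.ρ-zero K K-size M₂
                    (Allₚ.map⁺ (Allₚ.map⁺ (All.universal (λ u → drop-++ u zeroV) us)))))
      (+-identityʳ _)

  ρ-second : ∀ U → ρ (mapS (zeroV ++_) U) ≡ ρ₂ U
  ρ-second = ρ-embed M₂ (dropRetract n₁ n₂) σ-embed (λ X → m≤n+m _ _)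
    where
    σ-embed : ∀ U → σ (mapS (zeroV ++_) U) ≡ ρ₂ U
    σ-embed U@(_ , us) = cong₂ _+ℕ_
      (RankFunction.ρ-zero K K-size M₁ (Allₚ.map⁺ (Allₚ.map⁺ (All.universal (λ u → take-++ zeroV u) us))))
      (cong ρ₂ (LinearRetract.mapS-project-embed (dropRetract n₁ n₂) U))

  rank₁+rank₂≤rank : QMatroid.rank M₁ +ℕ QMatroid.rank M₂ ≤ QMatroid.rank M
  rank₁+rank₂≤rank with proj₂ (M-ds (fullS (n₁ +ℕ n₂)))
  ... | X , _ , _ , dE , dX , E-dim , X-dim , ρE+dX≡dE+σX
      with HasDim-exists (π₁ {n₁} {n₂} X) | HasDim-exists (π₂ {n₁} {n₂} X)
  ...   | d₁ , X₁-dim@(B₁ , _ , _ , X₁≤B₁) | d₂ , X₂-dim@(B₂ , _ , _ , X₂≤B₂) = +-cancelʳ-≤ dX _ _ (begin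
    (k₁ +ℕ k₂) +ℕ dX                ≤⟨ +-monoʳ-≤ (k₁ +ℕ k₂) (dim≤length X-dim X≤B₁+B₂) ⟩
    (k₁ +ℕ k₂) +ℕ (d₁ +ℕ d₂)        ≡⟨ +-interchange k₁ k₂ d₁ d₂ ⟩
    (k₁ +ℕ d₁) +ℕ (k₂ +ℕ d₂)        ≤⟨ +-mono-≤ ρ₁-gap ρ₂-gap ⟩
    (ρ₁' X +ℕ n₁) +ℕ (ρ₂' X +ℕ n₂)  ≡⟨ +-interchange (ρ₁' X) n₁ (ρ₂' X) n₂ ⟩
    σ X +ℕ (n₁ +ℕ n₂)               ≡⟨ cong (σ X +ℕ_) (HasDim-unique (HasDim-fullS _) E-dim) ⟩
    σ X +ℕ dE                       ≡⟨ +-comm (σ X) dE ⟩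
    dE +ℕ σ X                       ≡⟨ ρE+dX≡dE+σX ⟨
    ρ (fullS (n₁ +ℕ n₂)) +ℕ dX      ∎)
    where
    k₁ k₂ : ℕ
    k₁ = QMatroid.rank M₁
    k₂ = QMatroid.rank M₂
    ρ₁-gap : k₁ +ℕ d₁ ≤ ρ₁' X +ℕ n₁
    ρ₁-gap = RankFunction.ρ-gap≤dim-gap K K-size M₁ (λ x _ → ∈-fullS x) X₁-dim (HasDim-fullS n₁)
    ρ₂-gap : k₂ +ℕ d₂ ≤ ρ₂' X +ℕ n₂
    ρ₂-gap = RankFunction.ρ-gap≤dim-gap K K-size M₂ (λ x _ → ∈-fullS x) X₂-dim (HasDim-fullS n₂)
    X≤B₁+B₂ : X ≤S (d₁ +ℕ d₂ , map (_++ zeroV) B₁ ++ map (zeroV ++_) B₂)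
    X≤B₁+B₂ y y∈X = subst (InSpan _) (take++drop-⊕ n₁ y) (InSpan-⊕
      (InSpan-++ˡ _ (InSpan-map (LinearRetract.embed-isLinear (takeRetract n₁ n₂))
                                (X₁≤B₁ _ (InSpan-map (take-isLinear n₁) y∈X))))
      (InSpan-++ʳ _ (InSpan-map (LinearRetract.embed-isLinear (dropRetract n₁ n₂))
                                (X₂≤B₂ _ (InSpan-map (drop-isLinear n₁) y∈X)))))

module Representation {K L : Field} {m : ℕ} (E : Extension K L m) where
  open Extension E using (ι; ι-+; ι-*)
  open Rep E
  open Field L
  open LinAlg L
  open VectorSpace L
  module K = Field K
  module VK = VectorSpace K
  open import Algebra.Properties.Group (CommutativeRing.+-group commutativeRing) using (identityʳ-unique)
  open ≡-Reasoning

  ι-0 : ι K.0# ≡ 0#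
  ι-0 = identityʳ-unique (ι K.0#) (ι K.0#)
          (trans (sym (ι-+ K.0# K.0#)) (cong ι (CommutativeRing.+-identityʳ VK.commutativeRing K.0#)))

  map-ι-⊕ : ∀ {n} (u v : LK.Vect n) → map ι (u LK.⊕ v) ≡ map ι u ⊕ map ι v
  map-ι-⊕ [] [] = refl
  map-ι-⊕ (x ∷ u) (y ∷ v) = cong₂ _∷_ (ι-+ x y) (map-ι-⊕ u v)

  map-ι-· : ∀ {n} c (u : LK.Vect n) → map ι (c LK.· u) ≡ ι c · map ι u
  map-ι-· c u = trans (sym (map-∘ ι (c K.*_) u)) (trans (map-cong (ι-* c) u) (map-∘ (ι c *_) ι u))

  map-ι-lincomb : ∀ {n r} (c : Vec K.Carrier r) (ys : Vec (LK.Vect n) r) →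
                  map ι (LK.lincomb c ys) ≡ lincomb (map ι c) (map (map ι) ys)
  map-ι-lincomb [] [] = trans (map-replicate ι K.0# _) (cong (replicate _) ι-0)
  map-ι-lincomb (a ∷ c) (y ∷ ys) = trans (map-ι-⊕ _ _) (cong₂ _⊕_ (map-ι-· a y) (map-ι-lincomb c ys))

  -- By definition, apply G y is G *ᵥ map ι y.
  apply-⊕ : ∀ {k n} (G : Mat k n) u v → apply G (u LK.⊕ v) ≡ apply G u ⊕ apply G v
  apply-⊕ G u v = trans (cong (G *ᵥ_) (map-ι-⊕ u v)) (IsLinear.⊕-homo (*ᵥ-isLinear G) (map ι u) (map ι v))

  apply-lincomb : ∀ {k n r} (G : Mat k n) (c : Vec K.Carrier r) ys →
                  apply G (LK.lincomb c ys) ≡ lincomb (map ι c) (map (apply G) ys)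
  apply-lincomb G c ys = begin
    G *ᵥ map ι (LK.lincomb c ys)                      ≡⟨ cong (G *ᵥ_) (map-ι-lincomb c ys) ⟩
    G *ᵥ lincomb (map ι c) (map (map ι) ys)           ≡⟨ IsLinear.lincomb-homo (*ᵥ-isLinear G) (map ι c) _ ⟩
    lincomb (map ι c) (map (G *ᵥ_) (map (map ι) ys))  ≡⟨ cong (lincomb (map ι c)) (map-∘ (G *ᵥ_) (map ι) ys) ⟨
    lincomb (map ι c) (map (apply G) ys)              ∎

  InSpan-apply : ∀ {k n r} (G : Mat k n) {ys : Vec (LK.Vect n) r} {y} →
                 LK.InSpan ys y → InSpan (map (apply G) ys) (apply G y)
  InSpan-apply G {ys} (c , refl) = map ι c , sym (apply-lincomb G c ys)

  apply-blockDiag : ∀ {k₁ k₂ n₁ n₂} (G₁ : Mat k₁ n₁) (G₂ : Mat k₂ n₂) y →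
                    apply (blockDiag G₁ G₂) y ≡ apply G₁ (take n₁ y) ++ apply G₂ (drop n₁ y)
  apply-blockDiag {n₁ = n₁} G₁ G₂ y = trans (blockDiag-*ᵥ G₁ G₂ (map ι y))
    (cong₂ _++_ (cong (G₁ *ᵥ_) (take-map ι n₁ y)) (cong (G₂ *ᵥ_) (drop-map ι n₁ y)))

  record Factorisation {a n k} (G : Mat k n) (e : LK.Vect a → LK.Vect n) (k′ : ℕ) : Set where
    field
      matrix      : Mat k′ a
      basis       : Vec (Vect k) k′
      basis-indep : LinIndep basis
      factor      : ∀ z → lincomb (apply matrix z) basis ≡ apply G (e z)

  factor-through : ∀ {a n k k′} (G : Mat k n) {e : LK.Vect a → LK.Vect n} → VK.IsLinear e →
                   (b : Vec (Vect k) k′) → All (InSpan b) (map (apply G ∘ e) (tabulate LK.unitV)) →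
                   Σ (Mat k′ a) λ H → ∀ z → lincomb (apply H z) b ≡ apply G (e z)
  factor-through G {e} e-linear b units⊆b with coordinates units⊆b
  ... | C , C≡units = transpose C , λ z → begin
    lincomb (apply (transpose C) z) b
      ≡⟨ cong (λ w → lincomb w b) (transpose-*ᵥ C (map ι z)) ⟩
    lincomb (lincomb (map ι z) C) b
      ≡⟨ IsLinear.lincomb-homo (lincomb-isLinear b) (map ι z) C ⟩
    lincomb (map ι z) (map (λ c → lincomb c b) C)
      ≡⟨ cong (lincomb (map ι z)) C≡units ⟩
    lincomb (map ι z) (map (apply G ∘ e) (tabulate LK.unitV))
      ≡⟨ cong (lincomb (map ι z)) (map-∘ (apply G) e _) ⟩
    lincomb (map ι z) (map (apply G) (map e (tabulate LK.unitV)))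
      ≡⟨ apply-lincomb G z _ ⟨
    apply G (LK.lincomb z (map e (tabulate LK.unitV)))
      ≡⟨ cong (apply G) (VK.IsLinear.lincomb-homo e-linear z _) ⟨
    apply G (e (LK.lincomb z (tabulate LK.unitV)))
      ≡⟨ cong (apply G ∘ e) (VK.lincomb-unitV z) ⟩
    apply G (e z)
      ∎

  module _ {a n k} {G : Mat k n} {M : QMatroid K n} (G-rep : Represents G M) {N : QMatroid K a}
           (R : VK.LinearRetract a n)
           (ρ-embed : ∀ U → QMatroid.ρ M (VK.mapS (VK.LinearRetract.embed R) U) ≡ QMatroid.ρ N U) where
    open VK.LinearRetract R

    restrictionFactorisation : Factorisation G embed (QMatroid.rank N)
    restrictionFactorisation =
      let r , Y , (_ , image≤Y) , GY-dim = G-rep (VK.mapS embed (LK.fullS a))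
          b , b-indep , _ , GY≤b = subst (HasDim (r , map (apply G) Y)) (ρ-embed (LK.fullS a)) GY-dim
          unit-image⊆b : All (InSpan b) (map (apply G ∘ embed) (tabulate LK.unitV))
          unit-image⊆b = Allₚ.map⁺ (All.map
            (λ u∈ → GY≤b _ (InSpan-apply G (image≤Y _ (VK.InSpan-map embed-isLinear u∈))))
            (VK.InSpan-self (tabulate LK.unitV)))
          H , factor = factor-through G embed-isLinear b unit-image⊆b
      in record { matrix = H ; basis = b ; basis-indep = b-indep ; factor = factor }

    factorisation-represents : ∀ {k′} (F : Factorisation G embed k′) → Represents (Factorisation.matrix F) N
    factorisation-represents F U =
      let rY , Y , Y≐ , GY-dim = G-rep (VK.mapS embed U)
          HY-dim = subst₂ (λ ys d → HasDim (rY , ys) d)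
                          (sym (pulled-back (VK.≤S⇒All (proj₁ Y≐)))) (ρ-embed U) GY-dim
      in rY , map project Y , mapS-project-≐ Y≐ ,
         HasDim-mapS⁻ (lincomb-isLinear basis) (lincomb-injective basis-indep) HY-dim
      where
      open Factorisation F
      pulled-back : ∀ {t} {ys : Vec (LK.Vect n) t} → All (LK._∈ VK.mapS embed U) ys →
                    map (λ w → lincomb w basis) (map (apply matrix) (map project ys)) ≡ map (apply G) ys
      pulled-back [] = refl
      pulled-back (y∈ ∷ ys⊆) =
        cong₂ _∷_ (trans (factor _) (cong (apply G) (embed∘project-image y∈))) (pulled-back ys⊆)

  blockDiagFactorisation : ∀ {n₁ n₂ k k₁ k₂} {G : Mat k (n₁ +ℕ n₂)} {M : QMatroid K (n₁ +ℕ n₂)} →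
                           Represents G M → Factorisation G (_++ LK.zeroV) k₁ → Factorisation G (LK.zeroV ++_) k₂ →
                           k₁ +ℕ k₂ ≤ QMatroid.rank M → Factorisation G (λ y → y) (k₁ +ℕ k₂)
  blockDiagFactorisation {n₁} {n₂} {G = G} G-rep F₁ F₂ k₁+k₂≤rank = record
    { matrix = blockDiag H₁ H₂ ; basis = b₁ ++ b₂ ; basis-indep = b-indep ; factor = factor }
    where
    open Factorisation F₁ using () renaming (matrix to H₁; basis to b₁; factor to factor₁)
    open Factorisation F₂ using () renaming (matrix to H₂; basis to b₂; factor to factor₂)

    factor : ∀ y → lincomb (apply (blockDiag H₁ H₂) y) (b₁ ++ b₂) ≡ apply G y
    factor y = begin
      lincomb (apply (blockDiag H₁ H₂) y) (b₁ ++ b₂)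
        ≡⟨ cong (λ w → lincomb w (b₁ ++ b₂)) (apply-blockDiag H₁ H₂ y) ⟩
      lincomb (apply H₁ (take n₁ y) ++ apply H₂ (drop n₁ y)) (b₁ ++ b₂)
        ≡⟨ lincomb-++ (apply H₁ (take n₁ y)) (apply H₂ (drop n₁ y)) b₁ b₂ ⟩
      lincomb (apply H₁ (take n₁ y)) b₁ ⊕ lincomb (apply H₂ (drop n₁ y)) b₂
        ≡⟨ cong₂ _⊕_ (factor₁ _) (factor₂ _) ⟩
      apply G (take n₁ y ++ LK.zeroV) ⊕ apply G (LK.zeroV ++ drop n₁ y)
        ≡⟨ apply-⊕ G _ _ ⟨
      apply G ((take n₁ y ++ LK.zeroV) LK.⊕ (LK.zeroV ++ drop n₁ y))
        ≡⟨ cong (apply G) (VK.take++drop-⊕ n₁ y) ⟩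
      apply G y
        ∎

    b-indep : LinIndep (b₁ ++ b₂)
    b-indep =
      let _ , Y , _ , (bE , bE-indep , bE≤GY , _) = G-rep (LK.fullS (n₁ +ℕ n₂))
          GY⊆b = Allₚ.map⁺ (All.universal (λ y → apply (blockDiag H₁ H₂) y , factor y) Y)
      in spanning⇒LinIndep bE-indep (All.map (InSpan-trans GY⊆b) (≤S⇒All bE≤GY)) k₁+k₂≤rank

theorem3p4 : (q m : ℕ) (K L : Field) → HasSize K q → (E : Extension K L m) →
    (n₁ n₂ : ℕ) (M₁ : QMatroid K n₁) (M₂ : QMatroid K n₂) (M : QMatroid K (n₁ +ℕ n₂)) →
    DirectSum.IsDirectSum M₁ M₂ M →
    Rep.Representable E M →
      Rep.Representable E M₁ × Rep.Representable E M₂ ×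
      Σ (Rep.Mat E (QMatroid.rank M₁) n₁) (λ G₁ →
      Σ (Rep.Mat E (QMatroid.rank M₂) n₂) (λ G₂ →
        Rep.Represents E G₁ M₁ × Rep.Represents E G₂ M₂ ×
        Rep.Represents E (Rep.blockDiag E G₁ G₂) M))
theorem3p4 q m K L K-size E n₁ n₂ M₁ M₂ M M-ds (_ , G , G-rep) =
  (_ , H₁ , H₁-rep) , (_ , H₂ , H₂-rep) , H₁ , H₂ , H₁-rep , H₂-rep , H-rep
  where
  open LinAlg K using (zeroV)
  open VectorSpace K using (takeRetract; dropRetract; idRetract; mapS-id)
  open DirectSumRank K K-size M₁ M₂ M M-ds using (ρ-first; ρ-second; rank₁+rank₂≤rank)
  open Representation E
  open Rep E using (Mat; Represents; blockDiag)

  F₁ : Factorisation G (_++ zeroV) (QMatroid.rank M₁)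
  F₁ = restrictionFactorisation {M = M} G-rep {M₁} (takeRetract n₁ n₂) ρ-first

  F₂ : Factorisation G (zeroV ++_) (QMatroid.rank M₂)
  F₂ = restrictionFactorisation {M = M} G-rep {M₂} (dropRetract n₁ n₂) ρ-second

  H₁ : Mat (QMatroid.rank M₁) n₁
  H₁ = Factorisation.matrix F₁

  H₂ : Mat (QMatroid.rank M₂) n₂
  H₂ = Factorisation.matrix F₂

  H₁-rep : Represents H₁ M₁
  H₁-rep = factorisation-represents {M = M} G-rep {M₁} (takeRetract n₁ n₂) ρ-first F₁

  H₂-rep : Represents H₂ M₂
  H₂-rep = factorisation-represents {M = M} G-rep {M₂} (dropRetract n₁ n₂) ρ-second F₂

  H-rep : Represents (blockDiag H₁ H₂) M
  H-rep = factorisation-represents {M = M} G-rep {M} idRetract (cong (QMatroid.ρ M) ∘ mapS-id)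
            (blockDiagFactorisation {M = M} G-rep F₁ F₂ rank₁+rank₂≤rank)
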